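{- Let $G$ be a non-chordal finite simple graph, $H$ a hole of $G$, and $S$ the equivalence class under $\sim_G$ containing $V(H)$. Let $u,v$ be two nonadjacent vertices of $H$. If the graph $G+uv$ has a hole $H^*$ that is not a hole of $G$, then $V(H^*)\subseteq S$.
   Context: A hole is an induced cycle of length at least $4$; a graph is chordal if it has no hole. Let $\Omega(G)$ be the set of vertices of $G$ lying on at least one hole. For $u,v\in\Omega(G)$, $u\sim_G v$ if either $u$ and $v$ lie on a common hole, or there is a sequence $H_1,\ldots,H_t$ of distinct holes of $G$ with $u\in V(H_1)$, $v\in V(H_t)$, and $H_i$, $H_{i+1}$ sharing a vertex for each $i=1,\ldots,t-1$. This is an equivalence relation on $\Omega(G)$, and the vertices of each hole lie in a single class. -}

module Defs where

open import Data.Nat using (ℕ; zero; suc; _≤_)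
open import Data.Fin using (Fin; toℕ; _≟_)
open import Data.Bool using (Bool; true; false; _∨_; _∧_; T)
open import Data.Product using (Σ; ∃; _×_; _,_)
open import Data.Sum using (_⊎_)
open import Function using (_⇔_)
open import Function.Definitions using (Injective)
open import Relation.Binary.PropositionalEquality using (_≡_)
open import Relation.Nullary using (¬_)
open import Relation.Nullary.Decidable using (⌊_⌋)

Adj : ℕ → Set
Adj n = Fin n → Fin n → Bool

record Graph (n : ℕ) : Set where
  field
    adj    : Adj n
    sym    : ∀ x y → adj x y ≡ adj y x
    irrefl : ∀ x → adj x x ≡ false
open Graph public

CycAdj : (k : ℕ) → Fin k → Fin k → Set
CycAdj k i j =
  (suc (toℕ i) ≡ toℕ j) ⊎ (suc (toℕ j) ≡ toℕ i)
  ⊎ ((toℕ i ≡ 0) × (suc (toℕ j) ≡ k)) ⊎ ((toℕ j ≡ 0) × (suc (toℕ i) ≡ k))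

record Hole {n : ℕ} (E : Adj n) : Set where
  field
    len     : ℕ
    len≥4   : 4 ≤ len
    vertex  : Fin len → Fin n
    inj     : Injective _≡_ _≡_ vertex
    induced : ∀ i j → T (E (vertex i) (vertex j)) ⇔ CycAdj len i j
open Hole public

_∈V_ : {n : ℕ} {E : Adj n} → Fin n → Hole E → Set
x ∈V H = ∃ λ i → vertex H i ≡ x

-- same vertex set (a hole, being induced, is determined by its vertex set)
SameVertices : {n : ℕ} {E E' : Adj n} → Hole E → Hole E' → Set
SameVertices H H' = ∀ x → (x ∈V H) ⇔ (x ∈V H')

Chordal : {n : ℕ} → Graph n → Set
Chordal G = ¬ Hole (adj G)

addEdge : {n : ℕ} → Adj n → Fin n → Fin n → Adj n
addEdge E u v x y = E x y ∨ (⌊ x ≟ u ⌋ ∧ ⌊ y ≟ v ⌋) ∨ (⌊ x ≟ v ⌋ ∧ ⌊ y ≟ u ⌋)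

data _∼[_]_ {n : ℕ} : Fin n → Graph n → Fin n → Set where
  common : ∀ {G x y} (H : Hole (adj G)) → x ∈V H → y ∈V H → x ∼[ G ] y
  chain  : ∀ {G x z y} (H : Hole (adj G)) → x ∈V H → z ∈V H → z ∼[ G ] y → x ∼[ G ] y

module Submission where

-- H* must use the new edge uv, so deleting it leaves an induced
-- path p₀, …, p_M of G between u and v, with M ≥ 3, through all of V(H*).
-- We show p_t ∼ u by induction on t; p₀ and p_M lie on H.  Let x = p_{t+1}
-- be an inner node off H.  If x has neighbours inside both p₀–p_M arcs of H,
-- these are nonadjacent, and x misses p₀ or p_M; going around H from a
-- missed vertex, the first and the last neighbour of x bound a stretch of H
-- avoiding N[x], which closes through x into a hole meeting H.  Otherwise an
-- arc of H avoids N[x]; with the path it forms a walk from p_t to p_{t+2}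
-- avoiding N[x], which shortcuts to an induced path closing through x into a
-- hole that contains x and p_t.

open import Defs hiding (sym)
open import Data.Nat using (ℕ; zero; suc; _+_; _∸_; _≤_; _<_; z≤n; s≤s; s≤s⁻¹; _<?_; _≤?_)
open import Data.Nat.Properties hiding (_≟_)
open import Data.Fin using (Fin; toℕ; fromℕ<; _≟_)
import Data.Fin as Fin
open import Data.Fin.Properties using (toℕ-fromℕ<; toℕ-fromℕ; toℕ<n; toℕ-injective; any?)
open import Data.Bool using (T; false; _∧_)
open import Data.Bool.Properties using (T-∨; T-∧)
open import Data.Product using (Σ; ∃; _×_; _,_; proj₁; proj₂)
open import Data.Product.Function.NonDependent.Propositional using (_×-⇔_)
open import Data.Sum using (_⊎_; inj₁; inj₂)
import Data.Sum as Sum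
open import Data.Sum.Function.Propositional using (_⊎-⇔_)
open import Data.Empty using (⊥; ⊥-elim)
open import Function using (_⇔_; mk⇔; Equivalence; _∘_)
open import Function.Construct.Composition using (_⇔-∘_)
open import Function.Construct.Identity using (⇔-id)
open import Function.Construct.Symmetry using (⇔-sym)
open import Relation.Binary.PropositionalEquality
open import Relation.Nullary using (¬_; Dec; yes; no; contradiction)
open import Relation.Nullary.Decidable using (T?; _×-dec_; ⌊_⌋; toWitness; fromWitness)
open import Relation.Unary using (Decidable)

open Equivalence using (to; from)

-- Positions on a cycle and on a path.  A hole is indexed by Fin (len H); to
-- do arithmetic on positions we work with natural numbers instead.

CycAdjℕ : ℕ → ℕ → ℕ → Set
CycAdjℕ L i j =
  (suc i ≡ j) ⊎ (suc j ≡ i) ⊎ ((i ≡ 0) × (suc j ≡ L)) ⊎ ((j ≡ 0) × (suc i ≡ L))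

next : ℕ → ℕ → ℕ
next L i with suc i <? L
... | yes _ = suc i
... | no  _ = 0

next-cases : ∀ {L i} → i < L →
  (suc i < L × next L i ≡ suc i) ⊎ (suc i ≡ L × next L i ≡ 0)
next-cases {L} {i} i<L with suc i <? L
... | yes 1+i<L = inj₁ (1+i<L , refl)
... | no  1+i≮L = inj₂ (≤-antisym i<L (≮⇒≥ 1+i≮L) , refl)

next< : ∀ {L i} → i < L → next L i < L
next< {L} {i} i<L with next-cases i<L
... | inj₁ (1+i<L , e) = subst (_< L) (sym e) 1+i<L
... | inj₂ (_ , e)     = subst (_< L) (sym e) (≤-<-trans z≤n i<L)

next-injective : ∀ {L i j} → i < L → j < L → next L i ≡ next L j → i ≡ j
next-injective i<L j<L e with next-cases i<L | next-cases j<L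
... | inj₁ (_ , a)  | inj₁ (_ , b)  = suc-injective (trans (sym a) (trans e b))
... | inj₁ (_ , a)  | inj₂ (_ , b)  = contradiction (trans (sym a) (trans e b)) λ ()
... | inj₂ (_ , a)  | inj₁ (_ , b)  = contradiction (trans (sym b) (trans (sym e) a)) λ ()
... | inj₂ (ei , _) | inj₂ (ej , _) = suc-injective (trans ei (sym ej))

next-surjective : ∀ {L k} → k < L → ∃ λ i → i < L × next L i ≡ k
next-surjective {suc L} {zero} _ with next-cases {suc L} {L} ≤-refl
... | inj₁ (L<L , _) = contradiction L<L (<-irrefl refl)
... | inj₂ (_ , e)   = L , ≤-refl , e
next-surjective {L} {suc k} 1+k<L with next-cases {L} {k} (<-trans (n<1+n k) 1+k<L)
... | inj₁ (_ , e)     = k , <-trans (n<1+n k) 1+k<L , e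
... | inj₂ (1+k≡L , _) = contradiction 1+k<L (<-irrefl 1+k≡L)

CycAdjℕ⇔next : ∀ {L i j} → i < L → j < L →
  CycAdjℕ L i j ⇔ ((next L i ≡ j) ⊎ (next L j ≡ i))
CycAdjℕ⇔next {L} {i} {j} i<L j<L = mk⇔ forward backward
  where
  forward : CycAdjℕ L i j → (next L i ≡ j) ⊎ (next L j ≡ i)
  forward c with next-cases i<L | next-cases j<L | c
  ... | inj₁ (_ , a) | _ | inj₁ e = inj₁ (trans a e)
  ... | inj₂ (1+i≡L , _) | _ | inj₁ refl = contradiction j<L (<-irrefl 1+i≡L)
  ... | _ | inj₁ (_ , b) | inj₂ (inj₁ e) = inj₂ (trans b e)
  ... | _ | inj₂ (1+j≡L , _) | inj₂ (inj₁ refl) = contradiction i<L (<-irrefl 1+j≡L)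
  ... | _ | inj₁ (1+j<L , _) | inj₂ (inj₂ (inj₁ (_ , 1+j≡L))) = contradiction 1+j<L (<-irrefl 1+j≡L)
  ... | _ | inj₂ (_ , b) | inj₂ (inj₂ (inj₁ (i≡0 , _))) = inj₂ (trans b (sym i≡0))
  ... | inj₁ (1+i<L , _) | _ | inj₂ (inj₂ (inj₂ (_ , 1+i≡L))) = contradiction 1+i<L (<-irrefl 1+i≡L)
  ... | inj₂ (_ , a) | _ | inj₂ (inj₂ (inj₂ (j≡0 , _))) = inj₁ (trans a (sym j≡0))
  backward : (next L i ≡ j) ⊎ (next L j ≡ i) → CycAdjℕ L i j
  backward (inj₁ e) with next-cases i<L
  ... | inj₁ (_ , a)     = inj₁ (trans (sym a) e)
  ... | inj₂ (1+i≡L , a) = inj₂ (inj₂ (inj₂ (trans (sym e) a , 1+i≡L)))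
  backward (inj₂ e) with next-cases j<L
  ... | inj₁ (_ , b)     = inj₂ (inj₁ (trans (sym b) e))
  ... | inj₂ (1+j≡L , b) = inj₂ (inj₂ (inj₁ (trans (sym e) b , 1+j≡L)))

CycAdjℕ-next : ∀ {L i j} → i < L → j < L → CycAdjℕ L (next L i) (next L j) ⇔ CycAdjℕ L i j
CycAdjℕ-next {L} {i} {j} i<L j<L =
  mk⇔ (λ c → from (CycAdjℕ⇔next i<L j<L) (Sum.map (next-injective i'<L j<L) (next-injective j'<L i<L)
                                         (to (CycAdjℕ⇔next i'<L j'<L) c)))
      (λ c → from (CycAdjℕ⇔next i'<L j'<L) (Sum.map (cong (next L)) (cong (next L))
                                         (to (CycAdjℕ⇔next i<L j<L) c)))
  where
  i'<L = next< i<L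
  j'<L = next< j<L

far⇒¬CycAdjℕ : ∀ {L i j} → suc i < j → (0 < i ⊎ suc j < L) → ¬ CycAdjℕ L i j
far⇒¬CycAdjℕ 1+i<j _ (inj₁ e) = <-irrefl e 1+i<j
far⇒¬CycAdjℕ 1+i<j _ (inj₂ (inj₁ e)) = <-asym (subst (_ <_) e ≤-refl) (<-trans (n<1+n _) 1+i<j)
far⇒¬CycAdjℕ _ (inj₁ ()) (inj₂ (inj₂ (inj₁ (refl , _))))
far⇒¬CycAdjℕ _ (inj₂ 1+j<L) (inj₂ (inj₂ (inj₁ (_ , 1+j≡L)))) = <-irrefl 1+j≡L 1+j<L
far⇒¬CycAdjℕ () _ (inj₂ (inj₂ (inj₂ (refl , _))))

PathAdj : ℕ → ℕ → Set
PathAdj i j = (suc i ≡ j) ⊎ (suc j ≡ i)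

PathAdj-suc : ∀ {i j} → PathAdj (suc i) (suc j) ⇔ PathAdj i j
PathAdj-suc = mk⇔ (Sum.map suc-injective suc-injective) (Sum.map (cong suc) (cong suc))

PathAdj-+ʳ : ∀ {i j} k → PathAdj (i + k) (j + k) ⇔ PathAdj i j
PathAdj-+ʳ {i} {j} k = mk⇔ (Sum.map (+-cancelʳ-≡ k _ _) (+-cancelʳ-≡ k _ _))
                           (Sum.map (cong (_+ k)) (cong (_+ k)))

CycAdjℕ-sym : ∀ {L i j} → CycAdjℕ L i j ⇔ CycAdjℕ L j i
CycAdjℕ-sym = mk⇔ swap swap
  where
  swap : ∀ {L i j} → CycAdjℕ L i j → CycAdjℕ L j i
  swap (inj₁ e)                 = inj₂ (inj₁ e)
  swap (inj₂ (inj₁ e))          = inj₁ e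
  swap (inj₂ (inj₂ (inj₁ p)))   = inj₂ (inj₂ (inj₂ p))
  swap (inj₂ (inj₂ (inj₂ p)))   = inj₂ (inj₂ (inj₁ p))

CycAdjℕ-path : ∀ {r i j} → i ≤ r → j ≤ r → CycAdjℕ (suc (suc r)) i j ⇔ PathAdj i j
CycAdjℕ-path {r} {i} {j} i≤r j≤r = mk⇔ forward (Sum.map₂ inj₁)
  where
  forward : CycAdjℕ (suc (suc r)) i j → PathAdj i j
  forward (inj₁ e)                          = inj₁ e
  forward (inj₂ (inj₁ e))                   = inj₂ e
  forward (inj₂ (inj₂ (inj₁ (_ , 1+j≡2+r)))) = contradiction (s≤s j≤r) (<-irrefl 1+j≡2+r ∘ s≤s)
  forward (inj₂ (inj₂ (inj₂ (_ , 1+i≡2+r)))) = contradiction (s≤s i≤r) (<-irrefl 1+i≡2+r ∘ s≤s)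

CycAdjℕ-closing : ∀ {r j} → j ≤ r → CycAdjℕ (suc (suc r)) (suc r) j ⇔ ((j ≡ 0) ⊎ (j ≡ r))
CycAdjℕ-closing {r} {j} j≤r = mk⇔ forward backward
  where
  forward : CycAdjℕ (suc (suc r)) (suc r) j → (j ≡ 0) ⊎ (j ≡ r)
  forward (inj₁ refl)                = contradiction j≤r (<-irrefl refl ∘ m<n⇒m<1+n)
  forward (inj₂ (inj₁ e))            = inj₂ (suc-injective e)
  forward (inj₂ (inj₂ (inj₁ (() , _))))
  forward (inj₂ (inj₂ (inj₂ (e , _)))) = inj₁ e
  backward : (j ≡ 0) ⊎ (j ≡ r) → CycAdjℕ (suc (suc r)) (suc r) j
  backward (inj₁ e) = inj₂ (inj₂ (inj₂ (e , refl)))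
  backward (inj₂ e) = inj₂ (inj₁ (cong suc e))

CycAdjℕ-irrefl : ∀ {r i} → ¬ CycAdjℕ (suc (suc r)) i i
CycAdjℕ-irrefl (inj₁ e)                   = <-irrefl (sym e) (n<1+n _)
CycAdjℕ-irrefl (inj₂ (inj₁ e))            = <-irrefl (sym e) (n<1+n _)
CycAdjℕ-irrefl (inj₂ (inj₂ (inj₁ (refl , ()))))
CycAdjℕ-irrefl (inj₂ (inj₂ (inj₂ (refl , ()))))

-- Bounded searches in ℕ, used to find the first and the last neighbour of a
-- vertex along a stretch of a hole or a path.

least : ∀ {p} {P : ℕ → Set p} → Decidable P → ∀ k → (∃ λ j → j ≤ k × P j) →
        ∃ λ m → m ≤ k × P m × (∀ j → j < m → ¬ P j)
least P? zero (j , j≤0 , pj) = j , j≤0 , pj , λ i i<j _ → n≮0 (<-≤-trans i<j j≤0)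
least P? (suc k) (j , j≤1+k , pj) with anyUpTo? P? (suc k)
... | yes (i , i<1+k , pi) with least P? k (i , m<1+n⇒m≤n i<1+k , pi)
...   | m , m≤k , pm , minimal = m , m≤n⇒m≤1+n m≤k , pm , minimal
least P? (suc k) (j , j≤1+k , pj) | no none =
  j , j≤1+k , pj , λ i i<j pi → none (i , <-≤-trans i<j j≤1+k , pi)

first≥ : ∀ {p} {P : ℕ → Set p} → Decidable P → ∀ {lo k} → lo ≤ k → P k →
         ∃ λ m → lo ≤ m × m ≤ k × P m × (∀ j → lo ≤ j → j < m → ¬ P j)
first≥ P? {lo} {k} lo≤k pk with least (λ j → (lo ≤? j) ×-dec P? j) k (k , ≤-refl , lo≤k , pk)
... | m , m≤k , (lo≤m , pm) , minimal =
  m , lo≤m , m≤k , pm , λ j lo≤j j<m pj → minimal j j<m (lo≤j , pj)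

last< : ∀ {p} {P : ℕ → Set p} → Decidable P → ∀ {b} k → b < k → P b →
        ∃ λ m → b ≤ m × m < k × P m × (∀ j → m < j → j < k → ¬ P j)
last< {P = P} P? (suc k) b<1+k pb with P? k
... | yes pk = k , m<1+n⇒m≤n b<1+k , ≤-refl , pk ,
               λ j k<j j<1+k _ → <-irrefl refl (<-≤-trans k<j (m<1+n⇒m≤n j<1+k))
... | no ¬pk with m≤n⇒m<n∨m≡n (m<1+n⇒m≤n b<1+k)
...   | inj₂ refl = contradiction pb ¬pk
...   | inj₁ b<k with last< P? k b<k pb
...     | m , b≤m , m<k , pm , maximal = m , b≤m , m<n⇒m<1+n m<k , pm , beyond
  where
  beyond : ∀ j → m < j → j < suc k → ¬ P j
  beyond j m<j j<1+k with m≤n⇒m<n∨m≡n (m<1+n⇒m≤n j<1+k)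
  ... | inj₁ j<k  = maximal j m<j j<k
  ... | inj₂ refl = ¬pk

-- Reading a hole of an arbitrary adjacency E by positions in ℕ, and rotating
-- it.  Everything here is used both for G and for G + uv.
module Positions {n : ℕ} (E : Adj n) where

  len>0 : (H : Hole E) → 0 < len H
  len>0 H = ≤-trans (s≤s z≤n) (len≥4 H)

  len≢1 : (H : Hole E) → 1 ≢ len H
  len≢1 H 1≡L with subst (4 ≤_) (sym 1≡L) (len≥4 H)
  ... | s≤s ()

  -- The vertex at position j of a hole, read cyclically: position len H is
  -- position 0 again (see at-len).
  at : Hole E → ℕ → Fin n
  at H j with j <? len H
  ... | yes j<L = vertex H (fromℕ< j<L)
  ... | no  _   = vertex H (fromℕ< (len>0 H))

  at-fin : (H : Hole E) {j : ℕ} → j < len H → Σ (Fin (len H)) λ i → toℕ i ≡ j × at H j ≡ vertex H i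
  at-fin H {j} j<L with j <? len H
  ... | yes j<L' = fromℕ< j<L' , toℕ-fromℕ< j<L' , refl
  ... | no  j≮L  = contradiction j<L j≮L

  at-vertex : (H : Hole E) (i : Fin (len H)) → at H (toℕ i) ≡ vertex H i
  at-vertex H i with at-fin H (toℕ<n i)
  ... | i' , e , a = trans a (cong (vertex H) (toℕ-injective e))

  at-len : (H : Hole E) → at H (len H) ≡ at H 0
  at-len H with len H <? len H | at-fin H (len>0 H)
  ... | yes L<L | _ = contradiction L<L (<-irrefl refl)
  ... | no  _   | i , e , a = trans (cong (vertex H) (toℕ-injective (trans (toℕ-fromℕ< (len>0 H)) (sym e)))) (sym a)

  at-adj : (H : Hole E) {i j : ℕ} → i < len H → j < len H →
           T (E (at H i) (at H j)) ⇔ CycAdjℕ (len H) i j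
  at-adj H i<L j<L with at-fin H i<L | at-fin H j<L
  ... | i' , refl , a | j' , refl , b rewrite a | b = induced H i' j'

  at-injective : (H : Hole E) {i j : ℕ} → i < len H → j < len H → at H i ≡ at H j → i ≡ j
  at-injective H i<L j<L e with at-fin H i<L | at-fin H j<L
  ... | i' , refl , a | j' , refl , b = cong toℕ (inj H (trans (sym a) (trans e b)))

  at-∈V : (H : Hole E) {j : ℕ} → j < len H → at H j ∈V H
  at-∈V H j<L with at-fin H j<L
  ... | i , _ , a = i , sym a

  ∈V-at : (H : Hole E) {x : Fin n} → x ∈V H → ∃ λ j → j < len H × at H j ≡ x
  ∈V-at H (i , e) = toℕ i , toℕ<n i , trans (at-vertex H i) e

  at-step : (H : Hole E) {j : ℕ} → j < len H → T (E (at H j) (at H (suc j)))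
  at-step H {j} j<L with m≤n⇒m<n∨m≡n j<L
  ... | inj₁ 1+j<L = from (at-adj H j<L 1+j<L) (inj₁ refl)
  ... | inj₂ 1+j≡L = subst (λ y → T (E (at H j) y)) (trans (sym (at-len H)) (cong (at H) (sym 1+j≡L)))
                      (from (at-adj H j<L (len>0 H)) (inj₂ (inj₂ (inj₂ (refl , 1+j≡L)))))

  rotate : Hole E → Hole E
  rotate H = record
    { len     = len H
    ; len≥4   = len≥4 H
    ; vertex  = λ i → at H (next (len H) (toℕ i))
    ; inj     = λ {i} {j} e → toℕ-injective (next-injective (toℕ<n i) (toℕ<n j)
                  (at-injective H (next< (toℕ<n i)) (next< (toℕ<n j)) e))
    ; induced = λ i j → CycAdjℕ-next (toℕ<n i) (toℕ<n j) ⇔-∘ at-adj H (next< (toℕ<n i)) (next< (toℕ<n j))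
    }

  at-rotate : (H : Hole E) {j : ℕ} → j < len H → at (rotate H) j ≡ at H (next (len H) j)
  at-rotate H j<L with at-fin (rotate H) j<L
  ... | _ , refl , a = a

  rotate-same : (H : Hole E) → SameVertices (rotate H) H
  rotate-same H x = mk⇔ forward backward
    where
    forward : x ∈V rotate H → x ∈V H
    forward (i , e) with at-∈V H (next< (toℕ<n i))
    ... | i' , e' = i' , trans e' e
    backward : x ∈V H → x ∈V rotate H
    backward x∈H with ∈V-at H x∈H
    ... | k , k<L , e with next-surjective k<L
    ... | j , j<L , e' with at-∈V (rotate H) j<L
    ... | i , e'' = i , trans e'' (trans (at-rotate H j<L) (trans (cong (at H) e') e))

  rotate-to : (H : Hole E) {x : Fin n} → x ∈V H → Σ (Hole E) λ H' → SameVertices H' H × at H' 0 ≡ x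
  rotate-to H {x} x∈H with ∈V-at H x∈H
  ... | k , k<L , e = rotate-by k H k<L e
    where
    rotate-by : ∀ k (H : Hole E) → k < len H → at H k ≡ x → Σ (Hole E) λ H' → SameVertices H' H × at H' 0 ≡ x
    rotate-by zero    H _   e = H , (λ y → ⇔-id (y ∈V H)) , e
    rotate-by (suc k) H k<L e with next-cases (<-trans (n<1+n k) k<L)
    ... | inj₂ (1+k≡L , _) = contradiction k<L (<-irrefl 1+k≡L)
    ... | inj₁ (_ , nk) with rotate-by k (rotate H) (<-trans (n<1+n k) k<L)
                               (trans (at-rotate H (<-trans (n<1+n k) k<L)) (trans (cong (at H) nk) e))
    ...   | H' , same , e' = H' , (λ y → rotate-same H y ⇔-∘ same y) , e'

  edge-to-seam : (K : Hole E) {a b : Fin n} → a ∈V K → b ∈V K → T (E a b) →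
    Σ (Hole E) λ K' → SameVertices K' K × Σ ℕ λ M → len K' ≡ suc M ×
      ((at K' 0 ≡ a × at K' M ≡ b) ⊎ (at K' 0 ≡ b × at K' M ≡ a))
  edge-to-seam K {a} {b} a∈K b∈K a~b with rotate-to K a∈K
  ... | K₁ , same , h0≡a with ∈V-at K₁ (from (same b) b∈K)
  ... | l , l<L , hl≡b with to (at-adj K₁ (len>0 K₁) l<L) (subst₂ (λ y z → T (E y z)) (sym h0≡a) (sym hl≡b) a~b)
  ... | inj₁ refl = rotate K₁ , (λ y → same y ⇔-∘ rotate-same K₁ y) , M , 1+M≡L , inj₂ (at0 , atM)
    where
    M = proj₁ (m≤n⇒∃[o]m+o≡n (len>0 K₁))
    1+M≡L : len K₁ ≡ suc M
    1+M≡L = sym (proj₂ (m≤n⇒∃[o]m+o≡n (len>0 K₁)))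
    at0 : at (rotate K₁) 0 ≡ b
    at0 with next-cases (len>0 K₁)
    ... | inj₁ (_ , n0≡1) = trans (at-rotate K₁ (len>0 K₁)) (trans (cong (at K₁) n0≡1) hl≡b)
    ... | inj₂ (1≡L , _)  = contradiction 1≡L (len≢1 K₁)
    atM : at (rotate K₁) M ≡ a
    atM with next-cases {len K₁} {M} (subst (M <_) (sym 1+M≡L) ≤-refl)
    ... | inj₁ (1+M<L , _) = contradiction (subst (suc M <_) 1+M≡L 1+M<L) (<-irrefl refl)
    ... | inj₂ (_ , nM≡0)  = trans (at-rotate K₁ (subst (M <_) (sym 1+M≡L) ≤-refl)) (trans (cong (at K₁) nM≡0) h0≡a)
  ... | inj₂ (inj₁ ())
  ... | inj₂ (inj₂ (inj₁ (_ , 1+l≡L))) = K₁ , same , l , sym 1+l≡L , inj₁ (h0≡a , hl≡b)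
  ... | inj₂ (inj₂ (inj₂ (_ , 1≡L))) = contradiction 1≡L (len≢1 K₁)

-- Walks avoiding a closed neighbourhood N[x] in a graph G, induced paths, and
-- the construction of a hole through x from such a walk.
module Walks {n : ℕ} (G : Graph n) where

  E : Adj n
  E = adj G

  open Positions E public

  adj-sym : ∀ {a b} → T (E a b) ⇔ T (E b a)
  adj-sym {a} {b} = mk⇔ (subst T (Graph.sym G a b)) (subst T (Graph.sym G b a))

  adj-irrefl : ∀ {a} → ¬ T (E a a)
  adj-irrefl {a} = subst T (irrefl G a)

  adj⇒≢ : ∀ {a b} → T (E a b) → a ≢ b
  adj⇒≢ t refl = adj-irrefl t

  adj? : ∀ a b → Dec (T (E a b))
  adj? a b = T? (E a b)

  Avoids : Fin n → Fin n → Set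
  Avoids x c = (x ≢ c) × ¬ T (E x c)

  data Walk (x : Fin n) : Fin n → Fin n → Set where
    edge : ∀ {a b} → T (E a b) → Walk x a b
    step : ∀ {a c b} → T (E a c) → Avoids x c → Walk x c b → Walk x a b

  append : ∀ {x a c b} → Walk x a c → Avoids x c → Walk x c b → Walk x a b
  append (edge e)       c-avoids w = step e c-avoids w
  append (step e av w') c-avoids w = step e av (append w' c-avoids w)

  reverse : ∀ {x a b} → Walk x a b → Walk x b a
  reverse (edge e)      = edge (to adj-sym e)
  reverse (step e av w) = append (reverse w) av (edge (to adj-sym e))

  along : ∀ {x} (h : ℕ → Fin n) {i j} → i < j →
          (∀ k → i ≤ k → k < j → T (E (h k) (h (suc k)))) →
          (∀ k → i < k → k < j → Avoids x (h k)) → Walk x (h i) (h j)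
  along h {i} {suc j} (s≤s i≤j) steps avoid with m≤n⇒m<n∨m≡n i≤j
  ... | inj₂ refl = edge (steps i ≤-refl ≤-refl)
  ... | inj₁ i<j  = append (along h i<j (λ k i≤k k<j → steps k i≤k (m<n⇒m<1+n k<j))
                                        (λ k i<k k<j → avoid k i<k (m<n⇒m<1+n k<j)))
                           (avoid j i<j ≤-refl) (edge (steps j (<⇒≤ i<j) ≤-refl))

  record InducedPath (a b : Fin n) : Set where
    field
      hops      : ℕ
      node      : ℕ → Fin n
      node-0    : node 0 ≡ a
      node-hops : node hops ≡ b
      node-adj  : ∀ {i j} → i ≤ hops → j ≤ hops → T (E (node i) (node j)) ⇔ PathAdj i j
      node-inj  : ∀ {i j} → i ≤ hops → j ≤ hops → node i ≡ node j → i ≡ j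
  open InducedPath public

  InteriorAvoids : ∀ {a b} → Fin n → InducedPath a b → Set
  InteriorAvoids x P = ∀ i → 0 < i → i < hops P → Avoids x (node P i)

  AvoidingPath : Fin n → Fin n → Fin n → Set
  AvoidingPath x a b = Σ (InducedPath a b) (InteriorAvoids x)

  edge-path : ∀ {x a b} → T (E a b) → AvoidingPath x a b
  edge-path {a = a} {b} e = P , λ i 0<i i<1 → ⊥-elim (n≮0 (<-≤-trans 0<i (m<1+n⇒m≤n i<1)))
    where
    ends : ℕ → Fin n
    ends zero    = a
    ends (suc _) = b
    no-loop : ∀ {i} → ¬ PathAdj i i
    no-loop (inj₁ e) = <-irrefl (sym e) (n<1+n _)
    no-loop (inj₂ e) = <-irrefl (sym e) (n<1+n _)
    adjacency : ∀ {i j} → i ≤ 1 → j ≤ 1 → T (E (ends i) (ends j)) ⇔ PathAdj i j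
    adjacency {zero}  {zero}  _ _ = mk⇔ (⊥-elim ∘ adj-irrefl) (⊥-elim ∘ no-loop)
    adjacency {zero}  {suc _} _ (s≤s z≤n) = mk⇔ (λ _ → inj₁ refl) (λ _ → e)
    adjacency {suc _} {zero}  (s≤s z≤n) _ = mk⇔ (λ _ → inj₂ refl) (λ _ → to adj-sym e)
    adjacency {suc _} {suc _} (s≤s z≤n) (s≤s z≤n) = mk⇔ (⊥-elim ∘ adj-irrefl) (⊥-elim ∘ no-loop)
    injective : ∀ {i j} → i ≤ 1 → j ≤ 1 → ends i ≡ ends j → i ≡ j
    injective {zero}  {zero}  _ _ _ = refl
    injective {zero}  {suc _} _ (s≤s z≤n) a≡b = contradiction a≡b (adj⇒≢ e)
    injective {suc _} {zero}  (s≤s z≤n) _ b≡a = contradiction (sym b≡a) (adj⇒≢ e)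
    injective {suc _} {suc _} (s≤s z≤n) (s≤s z≤n) _ = refl
    P : InducedPath a b
    P = record { hops = 1 ; node = ends ; node-0 = refl ; node-hops = refl
               ; node-adj = adjacency ; node-inj = injective }

  suffix : ∀ {x c b} (P : InducedPath c b) → InteriorAvoids x P →
           ∀ {j} → j ≤ hops P → AvoidingPath x (node P j) b
  suffix {b = b} P P-avoids {j} j≤r = Q , λ i 0<i i<r∸j → P-avoids (i + j) (≤-trans 0<i (m≤m+n i j)) (shifted< i<r∸j)
    where
    shifted≤ : ∀ {i} → i ≤ hops P ∸ j → i + j ≤ hops P
    shifted≤ {i} = m≤o∸n⇒m+n≤o i j≤r
    shifted< : ∀ {i} → i < hops P ∸ j → i + j < hops P
    shifted< {i} = m≤o∸n⇒m+n≤o (suc i) j≤r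
    Q : InducedPath (node P j) b
    Q = record
      { hops      = hops P ∸ j
      ; node      = λ i → node P (i + j)
      ; node-0    = refl
      ; node-hops = trans (cong (node P) (m∸n+n≡m j≤r)) (node-hops P)
      ; node-adj  = λ i≤ i'≤ → PathAdj-+ʳ j ⇔-∘ node-adj P (shifted≤ i≤) (shifted≤ i'≤)
      ; node-inj  = λ i≤ i'≤ e → +-cancelʳ-≡ j _ _ (node-inj P (shifted≤ i≤) (shifted≤ i'≤) e)
      }

  cons : ∀ {x a c b} → T (E a c) → (Q : InducedPath c b) →
         (∀ i → i ≤ hops Q → node Q i ≢ a) →
         (∀ i → 0 < i → i ≤ hops Q → ¬ T (E a (node Q i))) →
         (0 < hops Q → Avoids x c) → InteriorAvoids x Q → AvoidingPath x a b
  cons {x} {a} {c} {b} a~c Q off-Q only-c c-avoids Q-avoids = P , interior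
    where
    nodes : ℕ → Fin n
    nodes zero    = a
    nodes (suc i) = node Q i
    a~first : T (E a (node Q 0))
    a~first = subst (λ y → T (E a y)) (sym (node-0 Q)) a~c
    adjacency : ∀ {i j} → i ≤ suc (hops Q) → j ≤ suc (hops Q) →
                T (E (nodes i) (nodes j)) ⇔ PathAdj i j
    adjacency {zero}        {zero}        _ _ = mk⇔ (⊥-elim ∘ adj-irrefl) λ { (inj₁ ()) ; (inj₂ ()) }
    adjacency {zero}        {suc zero}    _ _ = mk⇔ (λ _ → inj₁ refl) (λ _ → a~first)
    adjacency {zero}        {suc (suc j)} _ j≤ =
      mk⇔ (λ t → contradiction t (only-c (suc j) (s≤s z≤n) (s≤s⁻¹ j≤))) λ { (inj₁ ()) ; (inj₂ ()) }
    adjacency {suc zero}    {zero}        _ _ = mk⇔ (λ _ → inj₂ refl) (λ _ → to adj-sym a~first)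
    adjacency {suc (suc i)} {zero}        i≤ _ =
      mk⇔ (λ t → contradiction (to adj-sym t) (only-c (suc i) (s≤s z≤n) (s≤s⁻¹ i≤))) λ { (inj₁ ()) ; (inj₂ ()) }
    adjacency {suc i}       {suc j}       i≤ j≤ = ⇔-sym PathAdj-suc ⇔-∘ node-adj Q (s≤s⁻¹ i≤) (s≤s⁻¹ j≤)
    injective : ∀ {i j} → i ≤ suc (hops Q) → j ≤ suc (hops Q) → nodes i ≡ nodes j → i ≡ j
    injective {zero}  {zero}  _  _  _ = refl
    injective {zero}  {suc j} _  j≤ e = contradiction (sym e) (off-Q j (s≤s⁻¹ j≤))
    injective {suc i} {zero}  i≤ _  e = contradiction e (off-Q i (s≤s⁻¹ i≤))
    injective {suc i} {suc j} i≤ j≤ e = cong suc (node-inj Q (s≤s⁻¹ i≤) (s≤s⁻¹ j≤) e)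
    P : InducedPath a b
    P = record { hops = suc (hops Q) ; node = nodes ; node-0 = refl ; node-hops = node-hops Q
               ; node-adj = adjacency ; node-inj = injective }
    interior : InteriorAvoids x P
    interior (suc zero)    _ (s≤s 0<r) = subst (Avoids x) (sym (node-0 Q)) (c-avoids 0<r)
    interior (suc (suc i)) _ (s≤s i<r) = Q-avoids (suc i) (s≤s z≤n) i<r

  walk→path : ∀ {x a b} → Walk x a b → AvoidingPath x a b
  walk→path (edge e) = edge-path e
  walk→path {x} {a} {b} (step {c = c} a~c c-avoids w) with walk→path w
  ... | Q , Q-avoids with anyUpTo? (λ j → node Q j ≟ a) (suc (hops Q))
  ...   | yes (j , j<1+r , Qj≡a) = subst (λ y → AvoidingPath x y b) Qj≡a (suffix Q Q-avoids (m<1+n⇒m≤n j<1+r))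
  ...   | no a∉Q with last< (λ j → adj? a (node Q j)) (suc (hops Q)) (s≤s z≤n)
                              (subst (λ y → T (E a y)) (sym (node-0 Q)) a~c)
  ...     | m , _ , m<1+r , a~m , after-m = cons a~m R off-R only-first first-avoids R-avoids
    where
    m≤r = m<1+n⇒m≤n m<1+r
    R = proj₁ (suffix Q Q-avoids m≤r)
    R-avoids = proj₂ (suffix Q Q-avoids m≤r)
    off-R : ∀ i → i ≤ hops R → node R i ≢ a
    off-R i i≤ e = a∉Q (i + m , s≤s (m≤o∸n⇒m+n≤o i m≤r i≤) , e)
    only-first : ∀ i → 0 < i → i ≤ hops R → ¬ T (E a (node R i))
    only-first i 0<i i≤ = after-m (i + m) (+-monoˡ-≤ m 0<i) (s≤s (m≤o∸n⇒m+n≤o i m≤r i≤))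
    non-last-avoids : ∀ k → k < hops Q → Avoids x (node Q k)
    non-last-avoids zero    _   = subst (Avoids x) (sym (node-0 Q)) c-avoids
    non-last-avoids (suc k) k<r = Q-avoids (suc k) (s≤s z≤n) k<r
    first-avoids : 0 < hops R → Avoids x (node Q m)
    first-avoids 0<r∸m = non-last-avoids m (m∸n≢0⇒n<m (>⇒≢ 0<r∸m))

  two≤hops : ∀ {a b} (P : InducedPath a b) → a ≢ b → ¬ T (E a b) → 2 ≤ hops P
  two≤hops P a≢b a≁b with hops P | node-hops P | node-adj P {0} {1}
  ... | zero        | P0≡b | _     = contradiction (trans (sym (node-0 P)) P0≡b) a≢b
  ... | suc zero    | P1≡b | adj01 = contradiction
        (subst₂ (λ y z → T (E y z)) (node-0 P) P1≡b (from (adj01 z≤n ≤-refl) (inj₁ refl))) a≁b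
  ... | suc (suc _) | _    | _     = s≤s (s≤s z≤n)

  close : ∀ {x a b} (P : InducedPath a b) → InteriorAvoids x P → T (E x a) → T (E x b) →
          2 ≤ hops P → Σ (Hole E) λ C → x ∈V C × a ∈V C
  close {x} {a} {b} P P-avoids x~a x~b 2≤r =
    C , (Fin.fromℕ (suc r) , trans (cong closed (toℕ-fromℕ (suc r))) closed-x)
      , (Fin.zero , trans (closed-node z≤n) (node-0 P))
    where
    r = hops P
    end-or-interior : ∀ {j} → j ≤ r → (j ≡ 0) ⊎ (j ≡ r) ⊎ (0 < j × j < r)
    end-or-interior {zero} _ = inj₁ refl
    end-or-interior {suc j} j≤r with m≤n⇒m<n∨m≡n j≤r
    ... | inj₁ j<r = inj₂ (inj₂ (s≤s z≤n , j<r))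
    ... | inj₂ j≡r = inj₂ (inj₁ j≡r)
    x~node : ∀ {j} → j ≤ r → T (E x (node P j)) ⇔ ((j ≡ 0) ⊎ (j ≡ r))
    x~node {j} j≤r = mk⇔ forward backward
      where
      forward : T (E x (node P j)) → (j ≡ 0) ⊎ (j ≡ r)
      forward t with end-or-interior j≤r
      ... | inj₁ j≡0                  = inj₁ j≡0
      ... | inj₂ (inj₁ j≡r)           = inj₂ j≡r
      ... | inj₂ (inj₂ (0<j , j<r))   = contradiction t (proj₂ (P-avoids j 0<j j<r))
      backward : (j ≡ 0) ⊎ (j ≡ r) → T (E x (node P j))
      backward (inj₁ refl) = subst (λ y → T (E x y)) (sym (node-0 P)) x~a
      backward (inj₂ refl) = subst (λ y → T (E x y)) (sym (node-hops P)) x~b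
    x∉P : ∀ {j} → j ≤ r → x ≢ node P j
    x∉P j≤r with end-or-interior j≤r
    ... | inj₁ refl                 = λ e → adj⇒≢ x~a (trans e (node-0 P))
    ... | inj₂ (inj₁ refl)          = λ e → adj⇒≢ x~b (trans e (node-hops P))
    ... | inj₂ (inj₂ (0<j , j<r))   = proj₁ (P-avoids _ 0<j j<r)
    closed : ℕ → Fin n
    closed j with j ≤? r
    ... | yes _ = node P j
    ... | no  _ = x
    closed-node : ∀ {j} → j ≤ r → closed j ≡ node P j
    closed-node {j} j≤r with j ≤? r
    ... | yes _   = refl
    ... | no  j≰r = contradiction j≤r j≰r
    closed-x : closed (suc r) ≡ x
    closed-x with suc r ≤? r
    ... | yes 1+r≤r = contradiction 1+r≤r (<-irrefl refl)
    ... | no  _     = refl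
    path-or-x : ∀ {i} → i ≤ suc r → i ≤ r ⊎ i ≡ suc r
    path-or-x i≤1+r = Sum.map₁ m<1+n⇒m≤n (m≤n⇒m<n∨m≡n i≤1+r)
    adjacency : ∀ {i j} → i ≤ suc r → j ≤ suc r →
                T (E (closed i) (closed j)) ⇔ CycAdjℕ (suc (suc r)) i j
    adjacency i≤ j≤ with path-or-x i≤ | path-or-x j≤
    ... | inj₁ i≤r | inj₁ j≤r rewrite closed-node i≤r | closed-node j≤r =
          ⇔-sym (CycAdjℕ-path i≤r j≤r) ⇔-∘ node-adj P i≤r j≤r
    ... | inj₂ refl | inj₁ j≤r rewrite closed-x | closed-node j≤r =
          ⇔-sym (CycAdjℕ-closing j≤r) ⇔-∘ x~node j≤r
    ... | inj₁ i≤r | inj₂ refl rewrite closed-x | closed-node i≤r =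
          CycAdjℕ-sym ⇔-∘ (⇔-sym (CycAdjℕ-closing i≤r) ⇔-∘ (x~node i≤r ⇔-∘ adj-sym))
    ... | inj₂ refl | inj₂ refl rewrite closed-x =
          mk⇔ (⊥-elim ∘ adj-irrefl) (⊥-elim ∘ CycAdjℕ-irrefl)
    injective : ∀ {i j} → i ≤ suc r → j ≤ suc r → closed i ≡ closed j → i ≡ j
    injective i≤ j≤ e with path-or-x i≤ | path-or-x j≤
    ... | inj₁ i≤r | inj₁ j≤r rewrite closed-node i≤r | closed-node j≤r = node-inj P i≤r j≤r e
    ... | inj₂ refl | inj₁ j≤r rewrite closed-x | closed-node j≤r = contradiction e (x∉P j≤r)
    ... | inj₁ i≤r | inj₂ refl rewrite closed-x | closed-node i≤r = contradiction (sym e) (x∉P i≤r)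
    ... | inj₂ refl | inj₂ refl = refl
    bound : (k : Fin (suc (suc r))) → toℕ k ≤ suc r
    bound k = s≤s⁻¹ (toℕ<n k)
    C : Hole E
    C = record
      { len     = suc (suc r)
      ; len≥4   = s≤s (s≤s 2≤r)
      ; vertex  = λ k → closed (toℕ k)
      ; inj     = λ {k} {l} e → toℕ-injective (injective (bound k) (bound l) e)
      ; induced = λ k l → adjacency (bound k) (bound l)
      }

  hole-through : ∀ {x a b} → T (E x a) → T (E x b) → a ≢ b → ¬ T (E a b) → Walk x a b →
                 Σ (Hole E) λ C → x ∈V C × a ∈V C
  hole-through x~a x~b a≢b a≁b w with walk→path w
  ... | P , P-avoids = close P P-avoids x~a x~b (two≤hops P a≢b a≁b)

  far-avoids : ∀ {a b} (P : InducedPath a b) {i k} → i ≤ hops P → k ≤ hops P →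
               (suc i < k) ⊎ (suc k < i) → Avoids (node P i) (node P k)
  far-avoids P {i} {k} i≤ k≤ far =
    (λ e → distinct far (node-inj P i≤ k≤ e)) , (λ t → not-adjacent far (to (node-adj P i≤ k≤) t))
    where
    distinct : (suc i < k) ⊎ (suc k < i) → i ≢ k
    distinct (inj₁ 1+i<k) e = <-irrefl e (<-trans (n<1+n i) 1+i<k)
    distinct (inj₂ 1+k<i) e = <-irrefl (sym e) (<-trans (n<1+n k) 1+k<i)
    not-adjacent : (suc i < k) ⊎ (suc k < i) → ¬ PathAdj i k
    not-adjacent (inj₁ 1+i<k) (inj₁ e) = <-irrefl e 1+i<k
    not-adjacent (inj₁ 1+i<k) (inj₂ e) = <-asym (subst (k <_) e (n<1+n k)) (<-trans (n<1+n i) 1+i<k)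
    not-adjacent (inj₂ 1+k<i) (inj₁ e) = <-asym (subst (i <_) e (n<1+n i)) (<-trans (n<1+n k) 1+k<i)
    not-adjacent (inj₂ 1+k<i) (inj₂ e) = <-irrefl e 1+k<i

  -- Given a walk between the ends of an induced path P that avoids N[x] for
  -- x = node (t+1), walking back along P from node t to the start, then along
  -- the given walk, then back along P from the end to node (t+2) is a walk
  -- from node t to node (t+2) that still avoids N[x].
  detour : ∀ {a b} (P : InducedPath a b) {t} → suc (suc t) ≤ hops P →
           Walk (node P (suc t)) a b → Walk (node P (suc t)) (node P t) (node P (suc (suc t)))
  detour {a} {b} P {t} 2+t≤r w =
    back-from-end (hops P ∸ suc (suc t)) (≤-reflexive (m∸n+n≡m 2+t≤r))
      (subst (Walk x (node P t)) (trans (sym (node-hops P)) (cong (node P) (sym (m∸n+n≡m 2+t≤r))))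
             (from-start t ≤-refl))
    where
    x = node P (suc t)
    t≤r = ≤-trans (n≤1+n t) (≤-trans (n≤1+n (suc t)) 2+t≤r)
    from-start : ∀ k → k ≤ t → Walk x (node P k) b
    from-start zero    _   = subst (λ y → Walk x y b) (sym (node-0 P)) w
    from-start (suc k) k<t = step (from (node-adj P (≤-trans k<t t≤r) (≤-trans (<⇒≤ k<t) t≤r)) (inj₂ refl))
                                  (far-avoids P (≤-trans (n≤1+n (suc t)) 2+t≤r) (≤-trans (<⇒≤ k<t) t≤r) (inj₂ (s≤s k<t)))
                                  (from-start k (<⇒≤ k<t))
    back-from-end : ∀ d → d + suc (suc t) ≤ hops P →
                    Walk x (node P t) (node P (d + suc (suc t))) → Walk x (node P t) (node P (suc (suc t)))
    back-from-end zero    _ w' = w'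
    back-from-end (suc d) k<r w' =
      back-from-end d (<⇒≤ k<r)
        (append w' (far-avoids P (≤-trans (n≤1+n (suc t)) 2+t≤r) k<r (inj₁ (s≤s (m≤n+m (suc (suc t)) d))))
                (edge (from (node-adj P k<r (<⇒≤ k<r)) (inj₂ refl))))

-- How a vertex x off a hole H of G gets linked to H, and the main lemma.
module Links {n : ℕ} (G : Graph n) where

  open Walks G public

  off-hole : (H : Hole E) {x y : Fin n} → ¬ x ∈V H → y ∈V H → x ≢ y
  off-hole H x∉H y∈H refl = x∉H y∈H

  record TwoNeighbours (x : Fin n) (H : Hole E) : Set where
    field
      y z : Fin n
      y∈H : y ∈V H
      z∈H : z ∈V H
      x~y : T (E x y)
      x~z : T (E x z)
      y≢z : y ≢ z
      y≁z : ¬ T (E y z)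

  -- Reading H from
  -- w, the first and the last neighbour of x bound a stretch of H through w
  -- that avoids N[x]; closing it through x gives the hole.
  outside-vertex : (H : Hole E) {x w : Fin n} → ¬ x ∈V H → TwoNeighbours x H → w ∈V H → ¬ T (E x w) →
                   Σ (Hole E) λ C → x ∈V C × Σ (Fin n) λ v → v ∈V C × v ∈V H
  outside-vertex H {x} {w} x∉H two w∈H x≁w with rotate-to H w∈H
  ... | H' , same , h0≡w = C , x∈C , h α , hα∈C , to (same (h α)) (at-∈V H' α<L)
    where
    open TwoNeighbours two
    L = len H'
    h = at H'
    position : ∀ {v} → v ∈V H → ∃ λ k → k < L × h k ≡ v
    position v∈H = ∈V-at H' (from (same _) v∈H)
    x∉H' : ∀ {k} → k < L → x ≢ h k
    x∉H' k<L = off-hole H x∉H (to (same _) (at-∈V H' k<L))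
    i = proj₁ (position y∈H)
    i<L = proj₁ (proj₂ (position y∈H))
    hi≡y = proj₂ (proj₂ (position y∈H))
    j = proj₁ (position z∈H)
    j<L = proj₁ (proj₂ (position z∈H))
    hj≡z = proj₂ (proj₂ (position z∈H))
    x~hi : T (E x (h i))
    x~hi = subst (λ v → T (E x v)) (sym hi≡y) x~y
    x~hj : T (E x (h j))
    x~hj = subst (λ v → T (E x v)) (sym hj≡z) x~z
    nonzero : ∀ {k} → T (E x (h k)) → 0 < k
    nonzero {zero}  x~h0 = contradiction (subst (λ v → T (E x v)) h0≡w x~h0) x≁w
    nonzero {suc k} _    = s≤s z≤n
    first = first≥ (λ k → adj? x (h k)) (nonzero x~hi) x~hi
    last  = last< (λ k → adj? x (h k)) L i<L x~hi
    β = proj₁ first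
    α = proj₁ last
    0<β = proj₁ (proj₂ first)
    β≤i = proj₁ (proj₂ (proj₂ first))
    x~hβ = proj₁ (proj₂ (proj₂ (proj₂ first)))
    before-β = proj₂ (proj₂ (proj₂ (proj₂ first)))
    α<L = proj₁ (proj₂ (proj₂ last))
    x~hα = proj₁ (proj₂ (proj₂ (proj₂ last)))
    after-α = proj₂ (proj₂ (proj₂ (proj₂ last)))
    between : ∀ {k} → k < L → T (E x (h k)) → β ≤ k × k ≤ α
    between {k} k<L x~hk = ≮⇒≥ (λ k<β → before-β k (nonzero x~hk) k<β x~hk)
                         , ≮⇒≥ (λ α<k → after-α k α<k k<L x~hk)
    -- y and z sit at distinct, non-consecutive positions in [β, α]
    two-apart : suc β < α
    two-apart = ≰⇒> squeezed
      where
      β-or-next : ∀ {k} → β ≤ k → k ≤ α → α ≤ suc β → k ≡ β ⊎ k ≡ suc β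
      β-or-next β≤k k≤α α≤1+β with m≤n⇒m<n∨m≡n (≤-trans k≤α α≤1+β)
      ... | inj₁ k<1+β = inj₁ (≤-antisym (m<1+n⇒m≤n k<1+β) β≤k)
      ... | inj₂ k≡1+β = inj₂ k≡1+β
      same-or-adjacent : ∀ {k k'} → (k ≡ β ⊎ k ≡ suc β) → (k' ≡ β ⊎ k' ≡ suc β) → k ≡ k' ⊎ CycAdjℕ L k k'
      same-or-adjacent (inj₁ e) (inj₁ e') = inj₁ (trans e (sym e'))
      same-or-adjacent (inj₁ e) (inj₂ e') = inj₂ (inj₁ (trans (cong suc e) (sym e')))
      same-or-adjacent (inj₂ e) (inj₁ e') = inj₂ (inj₂ (inj₁ (trans (cong suc e') (sym e))))
      same-or-adjacent (inj₂ e) (inj₂ e') = inj₁ (trans e (sym e'))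
      squeezed : ¬ α ≤ suc β
      squeezed α≤1+β with same-or-adjacent (β-or-next (proj₁ (between i<L x~hi)) (proj₂ (between i<L x~hi)) α≤1+β)
                                           (β-or-next (proj₁ (between j<L x~hj)) (proj₂ (between j<L x~hj)) α≤1+β)
      ... | inj₁ i≡j = y≢z (trans (sym hi≡y) (trans (cong h i≡j) hj≡z))
      ... | inj₂ c    = y≁z (subst₂ (λ v v' → T (E v v')) hi≡y hj≡z (from (at-adj H' i<L j<L) c))
    β<L : β < L
    β<L = ≤-<-trans β≤i i<L
    hα≢hβ : h α ≢ h β
    hα≢hβ e = <-irrefl (at-injective H' β<L α<L (sym e)) (<-trans (n<1+n β) two-apart)
    hα≁hβ : ¬ T (E (h α) (h β))
    hα≁hβ t = far⇒¬CycAdjℕ two-apart (inj₁ 0<β) (to CycAdjℕ-sym (to (at-adj H' α<L β<L) t))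
    -- the stretch h α, …, h L = w = h 0, …, h β of H avoids N[x] inside
    w-avoids : Avoids x (h L)
    w-avoids rewrite at-len H' | h0≡w = off-hole H x∉H w∈H , x≁w
    up-to-w : Walk x (h α) (h L)
    up-to-w = along h α<L (λ k _ k<L → at-step H' k<L)
                          (λ k α<k k<L → x∉H' k<L , after-α k α<k k<L)
    from-w : Walk x (h 0) (h β)
    from-w = along h 0<β (λ k _ k<β → at-step H' (<-trans k<β β<L))
                         (λ k 0<k k<β → x∉H' (<-trans k<β β<L) , before-β k 0<k k<β)
    stretch : Walk x (h α) (h β)
    stretch = append up-to-w w-avoids (subst (λ v → Walk x v (h β)) (sym (at-len H')) from-w)
    closing = hole-through x~hα x~hβ hα≢hβ hα≁hβ stretch
    C = proj₁ closing
    x∈C = proj₁ (proj₂ closing)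
    hα∈C = proj₂ (proj₂ closing)

  arcs : (H : Hole E) {x a b : Fin n} → ¬ x ∈V H → a ∈V H → b ∈V H → a ≢ b →
         TwoNeighbours x H ⊎ Walk x a b
  arcs H {x} {a} {b} x∉H a∈H b∈H a≢b with rotate-to H a∈H
  ... | H' , same , h0≡a with ∈V-at H' (from (same b) b∈H)
  ... | q , q<L , hq≡b
    with anyUpTo? (λ k → (0 <? k) ×-dec adj? x (at H' k)) q
       | anyUpTo? (λ k → (q <? k) ×-dec adj? x (at H' k)) (len H')
  ... | yes (k₁ , k₁<q , 0<k₁ , x~k₁) | yes (k₂ , k₂<L , q<k₂ , x~k₂) = inj₁ (record
        { y = at H' k₁ ; z = at H' k₂
        ; y∈H = to (same _) (at-∈V H' k₁<L) ; z∈H = to (same _) (at-∈V H' k₂<L)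
        ; x~y = x~k₁ ; x~z = x~k₂
        ; y≢z = λ e → <-irrefl (at-injective H' k₁<L k₂<L e) (<-trans k₁<q q<k₂)
        ; y≁z = λ t → far⇒¬CycAdjℕ (≤-<-trans k₁<q q<k₂) (inj₁ 0<k₁) (to (at-adj H' k₁<L k₂<L) t)
        })
    where
    k₁<L = <-trans k₁<q q<L
  ... | no none-inside | _ = inj₂ (subst₂ (Walk x) h0≡a hq≡b
          (along (at H') 0<q (λ k _ k<q → at-step H' (<-trans k<q q<L))
                             (λ k 0<k k<q → x∉H' (<-trans k<q q<L) , λ t → none-inside (k , k<q , 0<k , t))))
    where
    x∉H' : ∀ {k} → k < len H' → x ≢ at H' k
    x∉H' k<L = off-hole H x∉H (to (same _) (at-∈V H' k<L))
    0<q : 0 < q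
    0<q = n≢0⇒n>0 λ { refl → a≢b (trans (sym h0≡a) hq≡b) }
  ... | yes _ | no none-outside = inj₂ (subst₂ (Walk x) (trans (at-len H') h0≡a) hq≡b
          (reverse (along (at H') q<L (λ k _ k<L → at-step H' k<L)
                                      (λ k q<k k<L → x∉H' k<L , λ t → none-outside (k , k<L , q<k , t)))))
    where
    x∉H' : ∀ {k} → k < len H' → x ≢ at H' k
    x∉H' k<L = off-hole H x∉H (to (same _) (at-∈V H' k<L))

  -- Walking along the
  -- path, a node x off H either links to H through outside-vertex, or an arc
  -- of H rerouted by detour joins x's two path-neighbours around N[x], so x
  -- shares a hole with its predecessor.
  path-on-hole : (H : Hole E) {a b u : Fin n} → u ∈V H → a ∈V H → b ∈V H →
                 (P : InducedPath a b) → 3 ≤ hops P → ∀ t → t ≤ hops P → node P t ∼[ G ] u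
  path-on-hole H {a} {b} {u} u∈H a∈H b∈H P 3≤r = reach
    where
    r = hops P
    a≢b : a ≢ b
    a≢b a≡b = <-irrefl (node-inj P z≤n ≤-refl (trans (node-0 P) (trans a≡b (sym (node-hops P)))))
                       (≤-trans (s≤s z≤n) 3≤r)
    -- an interior node is not adjacent to both ends, as the path has ≥ 3 edges
    misses-an-end : ∀ t → suc (suc t) ≤ r → Σ (Fin n) λ w → w ∈V H × ¬ T (E (node P (suc t)) w)
    misses-an-end t 2+t≤r with adj? (node P (suc t)) a
    ... | no  x≁a = a , a∈H , x≁a
    ... | yes x~a = b , b∈H , λ x~b →
          ends-apart (to (node-adj P 1+t≤r z≤n) (subst (λ y → T (E _ y)) (sym (node-0 P)) x~a))
                     (to (node-adj P 1+t≤r ≤-refl) (subst (λ y → T (E _ y)) (sym (node-hops P)) x~b))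
      where
      1+t≤r = <⇒≤ 2+t≤r
      ends-apart : PathAdj (suc t) 0 → PathAdj (suc t) r → ⊥
      ends-apart (inj₂ 1≡1+t) (inj₁ 2+t≡r) = <-irrefl (trans (cong suc 1≡1+t) 2+t≡r) 3≤r
      ends-apart _            (inj₂ 1+r≡1+t) = <-irrefl (sym (suc-injective 1+r≡1+t)) (<-trans (n<1+n t) 2+t≤r)
    link-off-hole : ∀ t → suc (suc t) ≤ r → ¬ node P (suc t) ∈V H → node P t ∼[ G ] u →
                    node P (suc t) ∼[ G ] u
    link-off-hole t 2+t≤r x∉H ih with arcs H x∉H a∈H b∈H a≢b
    ... | inj₁ two =
      let (w , w∈H , x≁w) = misses-an-end t 2+t≤r
          (C , x∈C , y , y∈C , y∈H) = outside-vertex H x∉H two w∈H x≁w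
      in chain C x∈C y∈C (common H y∈H u∈H)
    ... | inj₂ arc =
      let 1+t≤r = <⇒≤ 2+t≤r
          t≤r = <⇒≤ 1+t≤r
          apart = far-avoids P t≤r 2+t≤r (inj₁ ≤-refl)
          (C , x∈C , y∈C) = hole-through (from (node-adj P 1+t≤r t≤r) (inj₂ refl))
                                         (from (node-adj P 1+t≤r 2+t≤r) (inj₁ refl))
                                         (proj₁ apart) (proj₂ apart) (detour P 2+t≤r arc)
      in chain C x∈C y∈C ih
    advance : ∀ t → suc (suc t) ≤ r → node P t ∼[ G ] u → node P (suc t) ∼[ G ] u
    advance t 2+t≤r ih with any? (λ i → vertex H i ≟ node P (suc t))
    ... | yes x∈H = common H x∈H u∈H
    ... | no  x∉H = link-off-hole t 2+t≤r x∉H ih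
    reach : ∀ t → t ≤ r → node P t ∼[ G ] u
    reach zero _ = common H (subst (_∈V H) (sym (node-0 P)) a∈H) u∈H
    reach (suc t) 1+t≤r with m≤n⇒m<n∨m≡n 1+t≤r
    ... | inj₂ 1+t≡r = common H (subst (_∈V H) (sym (trans (cong (node P) 1+t≡r) (node-hops P))) b∈H) u∈H
    ... | inj₁ 2+t≤r = advance t 2+t≤r (reach t (<⇒≤ 1+t≤r))

-- The graph G + uv for nonadjacent u, v, and its holes that are not holes
-- of G.
module NewEdge {n : ℕ} (G : Graph n) (u v : Fin n) (u≁v : adj G u v ≡ false) where

  open Links G public

  E⁺ : Adj n
  E⁺ = addEdge E u v

  module P⁺ = Positions E⁺

  UV : Fin n → Fin n → Set
  UV a b = (a ≡ u × b ≡ v) ⊎ (a ≡ v × b ≡ u)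

  UV⇒≁ : ∀ {a b} → UV a b → ¬ T (E a b)
  UV⇒≁ (inj₁ (a≡u , b≡v)) t = subst T u≁v (subst₂ (λ y z → T (E y z)) a≡u b≡v t)
  UV⇒≁ (inj₂ (a≡v , b≡u)) t = subst T u≁v (subst₂ (λ y z → T (E y z)) b≡u a≡v (to adj-sym t))

  UV-∈V : ∀ {a b} (H : Hole E) → UV a b → u ∈V H → v ∈V H → a ∈V H × b ∈V H
  UV-∈V H (inj₁ (a≡u , b≡v)) u∈H v∈H = subst (_∈V H) (sym a≡u) u∈H , subst (_∈V H) (sym b≡v) v∈H
  UV-∈V H (inj₂ (a≡v , b≡u)) u∈H v∈H = subst (_∈V H) (sym a≡v) v∈H , subst (_∈V H) (sym b≡u) u∈H

  UV-cover : ∀ {a b c} → UV a b → (c ≡ u) ⊎ (c ≡ v) → (c ≡ a) ⊎ (c ≡ b)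
  UV-cover (inj₁ (a≡u , _))   (inj₁ c≡u) = inj₁ (trans c≡u (sym a≡u))
  UV-cover (inj₁ (_   , b≡v)) (inj₂ c≡v) = inj₂ (trans c≡v (sym b≡v))
  UV-cover (inj₂ (_   , b≡u)) (inj₁ c≡u) = inj₂ (trans c≡u (sym b≡u))
  UV-cover (inj₂ (a≡v , _))   (inj₂ c≡v) = inj₁ (trans c≡v (sym a≡v))

  ≟⇔≡ : ∀ {a b : Fin n} → T ⌊ a ≟ b ⌋ ⇔ (a ≡ b)
  ≟⇔≡ = mk⇔ toWitness fromWitness

  addEdge-T : ∀ {a b} → T (E⁺ a b) ⇔ (T (E a b) ⊎ UV a b)
  addEdge-T = (⇔-id _ ⊎-⇔ ((both ⊎-⇔ both) ⇔-∘ T-∨)) ⇔-∘ T-∨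
    where
    both : ∀ {a b c d : Fin n} → T (⌊ a ≟ c ⌋ ∧ ⌊ b ≟ d ⌋) ⇔ (a ≡ c × b ≡ d)
    both = (≟⇔≡ ×-⇔ ≟⇔≡) ⇔-∘ T-∧

  hole-of-G : (H* : Hole E⁺) → (∀ i → vertex H* i ≢ u) ⊎ (∀ i → vertex H* i ≢ v) → Hole E
  hole-of-G H* misses = record
    { len = len H* ; len≥4 = len≥4 H* ; vertex = vertex H* ; inj = inj H*
    ; induced = λ i j → induced H* i j ⇔-∘ mk⇔ (from addEdge-T ∘ inj₁) (old-edge misses i j ∘ to addEdge-T) }
    where
    old-edge : (∀ i → vertex H* i ≢ u) ⊎ (∀ i → vertex H* i ≢ v) → ∀ i j →
               T (E (vertex H* i) (vertex H* j)) ⊎ (vertex H* i ≡ u × vertex H* j ≡ v)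
                                                 ⊎ (vertex H* i ≡ v × vertex H* j ≡ u) →
               T (E (vertex H* i) (vertex H* j))
    old-edge _            i j (inj₁ t)                 = t
    old-edge (inj₁ no-u)  i j (inj₂ (inj₁ (eu , _)))   = contradiction eu (no-u i)
    old-edge (inj₂ no-v)  i j (inj₂ (inj₁ (_ , ev)))   = contradiction ev (no-v j)
    old-edge (inj₁ no-u)  i j (inj₂ (inj₂ (_ , eu)))   = contradiction eu (no-u j)
    old-edge (inj₂ no-v)  i j (inj₂ (inj₂ (ev , _)))   = contradiction ev (no-v i)

  through-u-v : (H* : Hole E⁺) → ¬ Σ (Hole E) (SameVertices H*) → u ∈V H* × v ∈V H*
  through-u-v H* new with any? (λ i → vertex H* i ≟ u) | any? (λ i → vertex H* i ≟ v)
  ... | yes u∈H* | yes v∈H* = u∈H* , v∈H*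
  ... | no  u∉H* | _        = contradiction (hole-of-G H* (inj₁ λ i e → u∉H* (i , e)) , λ y → ⇔-id _) new
  ... | yes _    | no v∉H*  = contradiction (hole-of-G H* (inj₂ λ i e → v∉H* (i , e)) , λ y → ⇔-id _) new

  record PathThrough (H* : Hole E⁺) : Set where
    field
      start end  : Fin n
      ends       : UV start end
      path       : InducedPath start end
      three≤hops : 3 ≤ hops path
      covers     : ∀ x → x ∈V H* → ∃ λ t → t ≤ hops path × node path t ≡ x

  -- A hole K of G + uv of length M+1 carrying u and v (in some order) at
  -- positions 0 and M, read as a path of G along positions 0, …, M.
  module Unrolled (K : Hole E⁺) (M : ℕ) (L≡1+M : len K ≡ suc M)
                  (seam : UV (P⁺.at K 0) (P⁺.at K M)) where

    p = P⁺.at K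
    <L : ∀ {i} → i ≤ M → i < len K
    <L i≤M = subst (_ <_) (sym L≡1+M) (s≤s i≤M)
    3≤M : 3 ≤ M
    3≤M = s≤s⁻¹ (subst (4 ≤_) L≡1+M (len≥4 K))
    end-position : ∀ {i} → i ≤ M → (p i ≡ u) ⊎ (p i ≡ v) → (i ≡ 0) ⊎ (i ≡ M)
    end-position i≤M pi∈uv = Sum.map (P⁺.at-injective K (<L i≤M) (<L z≤n))
                                     (P⁺.at-injective K (<L i≤M) (<L ≤-refl)) (UV-cover seam pi∈uv)
    ends-apart : ∀ {i j} → (i ≡ 0) ⊎ (i ≡ M) → (j ≡ 0) ⊎ (j ≡ M) → ¬ PathAdj i j
    ends-apart (inj₁ refl) (inj₁ refl) (inj₁ ())
    ends-apart (inj₁ refl) (inj₁ refl) (inj₂ ())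
    ends-apart (inj₁ refl) (inj₂ refl) (inj₁ 1≡M) = <-irrefl 1≡M (≤-trans (s≤s (s≤s z≤n)) 3≤M)
    ends-apart (inj₁ refl) (inj₂ refl) (inj₂ ())
    ends-apart (inj₂ refl) (inj₁ refl) (inj₁ ())
    ends-apart (inj₂ refl) (inj₁ refl) (inj₂ 1≡M) = <-irrefl 1≡M (≤-trans (s≤s (s≤s z≤n)) 3≤M)
    ends-apart (inj₂ refl) (inj₂ refl) (inj₁ 1+M≡M) = <-irrefl (sym 1+M≡M) (n<1+n M)
    ends-apart (inj₂ refl) (inj₂ refl) (inj₂ 1+M≡M) = <-irrefl (sym 1+M≡M) (n<1+n M)
    cyclic : ∀ {i j} → i ≤ M → j ≤ M → T (E⁺ (p i) (p j)) ⇔ CycAdjℕ (suc M) i j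
    cyclic {i} {j} i≤M j≤M = subst (λ L → T (E⁺ (p i) (p j)) ⇔ CycAdjℕ L i j) L≡1+M (P⁺.at-adj K (<L i≤M) (<L j≤M))
    adjacency : ∀ {i j} → i ≤ M → j ≤ M → T (E (p i) (p j)) ⇔ PathAdj i j
    adjacency {i} {j} i≤M j≤M = mk⇔ forward backward
      where
      forward : T (E (p i) (p j)) → PathAdj i j
      forward t with to (cyclic i≤M j≤M) (from addEdge-T (inj₁ t))
      ... | inj₁ e = inj₁ e
      ... | inj₂ (inj₁ e) = inj₂ e
      ... | inj₂ (inj₂ (inj₁ (refl , 1+j≡1+M))) rewrite suc-injective 1+j≡1+M = contradiction t (UV⇒≁ seam)
      ... | inj₂ (inj₂ (inj₂ (refl , 1+i≡1+M))) rewrite suc-injective 1+i≡1+M = contradiction (to adj-sym t) (UV⇒≁ seam)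
      backward : PathAdj i j → T (E (p i) (p j))
      backward c with to addEdge-T (from (cyclic i≤M j≤M) (Sum.map₂ inj₁ c))
      ... | inj₁ t = t
      ... | inj₂ (inj₁ (pi≡u , pj≡v)) = contradiction c (ends-apart (end-position i≤M (inj₁ pi≡u)) (end-position j≤M (inj₂ pj≡v)))
      ... | inj₂ (inj₂ (pi≡v , pj≡u)) = contradiction c (ends-apart (end-position i≤M (inj₂ pi≡v)) (end-position j≤M (inj₁ pj≡u)))
    path : InducedPath (p 0) (p M)
    path = record { hops = M ; node = p ; node-0 = refl ; node-hops = refl
                  ; node-adj = adjacency ; node-inj = λ i≤ j≤ → P⁺.at-injective K (<L i≤) (<L j≤) }

  open-at-uv : (H* : Hole E⁺) → u ∈V H* → v ∈V H* → PathThrough H*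
  open-at-uv H* u∈H* v∈H* with P⁺.edge-to-seam H* u∈H* v∈H* (from addEdge-T (inj₂ (inj₁ (refl , refl))))
  ... | K , same , M , L≡1+M , seam = record
    { start = P⁺.at K 0 ; end = P⁺.at K M ; ends = seam ; path = path ; three≤hops = 3≤M
    ; covers = λ x x∈H* → let (t , t<L , e) = P⁺.∈V-at K (from (same x) x∈H*)
                          in t , s≤s⁻¹ (subst (t <_) L≡1+M t<L) , e }
    where open Unrolled K M L≡1+M seam

proposition4p12 : {n : ℕ} (G : Graph n) → ¬ Chordal G → (H : Hole (adj G))
    → (u v : Fin n) → u ∈V H → v ∈V H → ¬ (u ≡ v) → adj G u v ≡ false
    → (H* : Hole (addEdge (adj G) u v))
    → ¬ (Σ (Hole (adj G)) (λ H' → SameVertices H* H'))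
    → ∀ x → x ∈V H* → x ∼[ G ] u
proposition4p12 G _ H u v u∈H v∈H _ u≁v H* new x x∈H* =
  follow (open-at-uv H* (proj₁ (through-u-v H* new)) (proj₂ (through-u-v H* new)))
  where
  open NewEdge G u v u≁v
  follow : PathThrough H* → x ∼[ G ] u
  follow opened = subst (_∼[ G ] u) node-t≡x
                   (path-on-hole H u∈H (proj₁ ends-on-H) (proj₂ ends-on-H) path three≤hops t t≤r)
    where
    open PathThrough opened
    ends-on-H = UV-∈V H ends u∈H v∈H
    t = proj₁ (covers x x∈H*)
    t≤r = proj₁ (proj₂ (covers x x∈H*))
    node-t≡x = proj₂ (proj₂ (covers x x∈H*))
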